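{- Let $T$ be a framed tableau and let $i<j$ be two columns of $T$ of the same height $n$, with entries listed from bottom to top $a_1,\dots,a_n$ (column $i$) and $b_1,\dots,b_n$ (column $j$). Then $b_k-a_k\le1$ for all $1\le k\le n$.
   Context: For a partition $\mu=(\mu_1\ge\dots\ge\mu_r)$, $D_\mu=\{(i,j):1\le i\le r,1\le j\le\mu_i\}$ (row $i$ from the bottom, column $j$ from the left); a tableau is $T:D_\mu\to\mathbb{Z}_{>0}$, $t_{i,j}=T(i,j)$, $t_{i,j}=\infty$ off $D_\mu$. $\mathrm{Bcomp}(c,m)$ is the unique weakly increasing integer sequence of length $m$ with sum $c$ and max minus min at most $1$. $(\mu,s)$, $s=(s_1,\dots,s_r)$, satisfies the framing condition if $s_i\ge(2i-1)\mu_i$ for all $i$ and $s_{i+1}\ge s_i+2\mu_i$ whenever $\mu_{i+1}=\mu_i$. $\mathrm{Fram}(\mu,s)$ (with $\mu_{r+1}=0$): row $r$ is $\mathrm{Bcomp}(s_r,\mu_r)$; for $i=r-1$ down to $1$: $a=s_i$, $b=\mu_i$; for $k=r,\dots,i$: $(r_{i,\mu_{k+1}+1},\dots,r_{i,\mu_i})=\mathrm{Bcomp}(a,b)$; if $r_{i,j}\le t_{i+1,j}-2$ for all $\mu_{k+1}<j\le\mu_k$ set $t_{i,j}=r_{i,j}$ for these $j$, else $t_{i,j}=t_{i+1,j}-2$ for these $j$; then $a:=a-\sum_{\mu_{k+1}<j\le\mu_k}t_{i,j}$, $b:=b-(\mu_k-\mu_{k+1})$. A framed tableau is $\mathrm{Fram}(\mu,s)$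 for some $(\mu,s)$ satisfying the framing condition. -}

module Defs where

open import Data.Nat as ℕ using (ℕ; zero; suc; _∸_)
open import Data.Integer as ℤ using (ℤ; +_; _-_; _+_; _*_; _≤_; _/ℕ_; _%ℕ_; _≤ᵇ_)
open import Data.List using (List; []; _∷_; _++_; length; take; map; replicate; filter; foldr)
open import Data.Bool.ListAction using (and)
open import Data.Maybe using (Maybe; just; nothing)
open import Data.Bool using (Bool; true; false; if_then_else_)
open import Data.Product using (_×_; _,_; proj₁)
open import Data.Unit using (⊤)

-- 1-based list access.  `nth xs i` is the i-th entry (i ≥ 1), if any.

nth : {A : Set} → List A → ℕ → Maybe A
nth []       _             = nothing
nth (x ∷ xs) zero          = nothing
nth (x ∷ xs) (suc zero)    = just x
nth (x ∷ xs) (suc (suc i)) = nth xs (suc i)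

-- 1-based access with a default value (used for μ_i with μ_i = 0 beyond r)
nthD : {A : Set} → A → List A → ℕ → A
nthD d xs i with nth xs i
... | just x  = x
... | nothing = d

sumℤ : List ℤ → ℤ
sumℤ = foldr _+_ (+ 0)

-- Bcomp(c, m): weakly increasing length-m integer sequence with sum c
-- and max - min ≤ 1:  (m - (c mod m)) copies of ⌊c/m⌋ followed by
-- (c mod m) copies of ⌊c/m⌋ + 1.  For m = 0 it is the empty sequence.

Bcomp : ℤ → ℕ → List ℤ
Bcomp c zero    = []
Bcomp c (suc m) =
  replicate (suc m ∸ (c %ℕ suc m)) (c /ℕ suc m)
  ++ replicate (c %ℕ suc m) ((c /ℕ suc m) + + 1)

-- Fram(μ, s).  μ and s are lists of length r (index 1 = bottom row).
-- Rows are produced as lists of entries, left to right; a tableau is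
-- the list of its rows from bottom (row 1) to top (row r).

module FramAlg (μ : List ℕ) (s : List ℤ) where

  r : ℕ
  r = length μ

  mu : ℕ → ℕ
  mu = nthD 0 μ

  sv : ℕ → ℤ
  sv = nthD (+ 0) s

  -- entry t_{i+1,j} of the row above (nothing = ∞, off the diagram)
  aboveAt : List ℤ → ℕ → Maybe ℤ
  aboveAt above j = nth above j

  okAt : List ℤ → ℕ → ℤ → Bool
  okAt above j x with aboveAt above j
  ... | nothing = true
  ... | just t  = x ≤ᵇ (t - + 2)

  -- t_{i+1,j} - 2 (the default 0 is never used: in that branch every
  -- column concerned has an entry in row i+1)
  lowered : List ℤ → ℕ → ℤ
  lowered above j = nthD (+ 0) above j - + 2

  indexFrom : ℕ → List ℤ → List (ℕ × ℤ)
  indexFrom lo []       = []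
  indexFrom lo (x ∷ xs) = (suc lo , x) ∷ indexFrom (suc lo) xs

  -- one step (index k) of the inner loop for row i, with the current
  -- values a, b.  Returns the entries t_{i,j} for μ_{k+1} < j ≤ μ_k and
  -- the updated a and b.
  stepK : List ℤ → ℕ → ℤ → ℕ → List ℤ × ℤ × ℕ
  stepK above k a b =
    let lo  = mu (suc k)
        hi  = mu k
        len = hi ∸ lo
        rs  = take len (Bcomp a b)
        ps  = indexFrom lo rs
        ok  = and (map (λ p → okAt above (proj₁ p) (Data.Product.proj₂ p)) ps)
        seg = if ok then rs else map (λ p → lowered above (proj₁ p)) ps
    in seg , (a - sumℤ seg) , (b ∸ len)

  steps : List ℤ → (i : ℕ) → (d : ℕ) → ℤ → ℕ → List ℤ
  steps above i zero    a b = proj₁ (stepK above i a b)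
  steps above i (suc d) a b with stepK above (i ℕ.+ suc d) a b
  ... | seg , a' , b' = seg ++ steps above i d a' b'

  buildRow : ℕ → List ℤ → List ℤ
  buildRow i above = steps above i (r ∸ i) (sv i) (mu i)

  rowsDown : ℕ → List ℤ → List (List ℤ)
  rowsDown zero    above = []
  rowsDown (suc i) above = rowsDown i row ++ (row ∷ [])
    where row = buildRow (suc i) above

  fram : List (List ℤ)
  fram with r
  ... | zero   = []
  ... | suc r' = rowsDown r' rowR ++ (rowR ∷ [])
    where rowR = Bcomp (sv (suc r')) (mu (suc r'))

Fram : List ℕ → List ℤ → List (List ℤ)
Fram μ s = FramAlg.fram μ s

data Decreasing : List ℕ → Set where
  []  : Decreasing []
  [_] : ∀ x → Decreasing (x ∷ [])
  _∷_ : ∀ {x y xs} → y ℕ.≤ x → Decreasing (y ∷ xs) → Decreasing (x ∷ y ∷ xs)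

IsPartition : List ℕ → Set
IsPartition μ = Decreasing μ × (∀ i → 1 ℕ.≤ i → i ℕ.≤ length μ → 1 ℕ.≤ nthD 0 μ i)

FramingCondition : List ℕ → List ℤ → Set
FramingCondition μ s =
  IsPartition μ
  × length s ≡ length μ
  × (∀ i → 1 ℕ.≤ i → i ℕ.≤ length μ →
       + ((2 ℕ.* i ∸ 1) ℕ.* mu i) ≤ sv i)
  × (∀ i → 1 ℕ.≤ i → suc i ℕ.≤ length μ → mu (suc i) ≡ mu i →
       sv i + + (2 ℕ.* mu i) ≤ sv (suc i))
  where
    open FramAlg μ s
    open import Relation.Binary.PropositionalEquality using (_≡_)

-- Tableaux as lists of rows (bottom to top), 1-based entry access.

Tableau : Set
Tableau = List (List ℤ)

IsFramed : Tableau → Set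
IsFramed T = Data.Product.∃ λ μ → Data.Product.∃ λ s →
  FramingCondition μ s Data.Product.× T Relation.Binary.PropositionalEquality.≡ Fram μ s
  where import Relation.Binary.PropositionalEquality

-- t_{k,j}: entry in row k, column j (default 0 off the diagram; only
-- used at cells of the diagram)
entry : Tableau → ℕ → ℕ → ℤ
entry T k j = nthD (+ 0) (nthD [] T k) j

colHeight : Tableau → ℕ → ℕ
colHeight T j = length (filter (λ row → j ℕ.≤? length row) T)

module Submission where

-- Let T = Fram(μ, s).  Row k of T has μ_k cells, so column j has height n
-- exactly when μ_{n+1} < j ≤ μ_n; call this set of columns block n.  Two
-- columns of the same height n thus lie in block n, and for k ≤ n both have
-- a cell in row k.  The proof is the invariant that in every row every block
-- is balanced: all its entries lie in {q, q+1} for a single q.  Two entries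
-- of a balanced block differ by at most 1, which is the theorem.
--
-- The invariant holds because row i is assembled, block by block from the
-- right, out of segments that are either an initial piece of some Bcomp
-- (balanced by construction) or the same block of row i+1 lowered by 2
-- (balanced by induction on the rows, from the top row down).

open import Defs
open import Data.Nat using (ℕ; _<_; _≤_)
open import Data.Integer using (_-_) renaming (_≤_ to _≤ℤ_)
open import Relation.Binary.PropositionalEquality using (_≡_)
open import Data.Integer using (+_)

open import Data.Nat using (zero; suc; _+_; _∸_; _⊓_; z≤n; s≤s; s≤s⁻¹; _≤?_)
import Data.Nat.Properties as ℕP
open import Data.Integer using (ℤ; _/ℕ_; _%ℕ_) renaming (_+_ to _+ℤ_; -_ to -ℤ_)
import Data.Integer.Properties as ℤP
open import Data.Integer.DivMod using (n%ℕd<d)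
open import Data.Integer.Tactic.RingSolver using (solve-∀)
open import Data.List using (List; []; _∷_; _++_; length; take; map; replicate; filter)
import Data.List.Properties as LP
open import Data.List.Relation.Unary.All using (All; []; _∷_)
import Data.List.Relation.Unary.All.Properties as AllP
open import Data.Maybe using (just; nothing; fromMaybe)
open import Data.Bool using (Bool; true; false; if_then_else_)
open import Data.Bool.ListAction using (and)
open import Data.Product using (∃; _×_; _,_; proj₁; proj₂)
open import Data.Sum using (inj₁; inj₂)
open import Data.Empty using (⊥-elim)
open import Function using (_∘_)
open import Relation.Nullary using (yes; no; does)
open import Relation.Unary using (Decidable)
open import Relation.Binary.PropositionalEquality
  using (refl; sym; trans; cong; cong₂; subst; subst₂; module ≡-Reasoning)

-- Lookup with a default, 1-based: `at d xs k` is the k-th entry of xs, or d.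
-- Unlike `nthD` it is structurally recursive, so it computes on cons cells.
at : {A : Set} → A → List A → ℕ → A
at d []       _             = d
at d (x ∷ xs) zero          = d
at d (x ∷ xs) (suc zero)    = x
at d (x ∷ xs) (suc (suc k)) = at d xs (suc k)

fromMaybe-nth : {A : Set} (d : A) (xs : List A) (k : ℕ) → fromMaybe d (nth xs k) ≡ at d xs k
fromMaybe-nth d []       k             = refl
fromMaybe-nth d (x ∷ xs) zero          = refl
fromMaybe-nth d (x ∷ xs) (suc zero)    = refl
fromMaybe-nth d (x ∷ xs) (suc (suc k)) = fromMaybe-nth d xs (suc k)

nthD≡at : {A : Set} (d : A) (xs : List A) (k : ℕ) → nthD d xs k ≡ at d xs k
nthD≡at d xs k with nth xs k | fromMaybe-nth d xs k
... | just x  | eq = eq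
... | nothing | eq = eq

at-beyond : {A : Set} (d : A) (xs : List A) {k : ℕ} → length xs < k → at d xs k ≡ d
at-beyond d []       _                       = refl
at-beyond d (x ∷ xs) {suc (suc k)} (s≤s lt) = at-beyond d xs lt

at-++ˡ : {A : Set} (d : A) (xs ys : List A) {k : ℕ} → 1 ≤ k → k ≤ length xs →
  at d (xs ++ ys) k ≡ at d xs k
at-++ˡ d (x ∷ xs) ys {suc zero}    _ _        = refl
at-++ˡ d (x ∷ xs) ys {suc (suc k)} _ (s≤s le) = at-++ˡ d xs ys (s≤s z≤n) le

at-last : {A : Set} (d : A) (xs : List A) (y : A) → at d (xs ++ y ∷ []) (suc (length xs)) ≡ y
at-last d []       y = refl
at-last d (x ∷ xs) y = at-last d xs y

at-map : {A B : Set} (f : A → B) (d : A) (xs : List A) (k : ℕ) → at (f d) (map f xs) k ≡ f (at d xs k)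
at-map f d []       k             = refl
at-map f d (x ∷ xs) zero          = refl
at-map f d (x ∷ xs) (suc zero)    = refl
at-map f d (x ∷ xs) (suc (suc k)) = at-map f d xs (suc k)

at-ext : {A : Set} (d : A) (xs ys : List A) → length xs ≡ length ys →
  (∀ k → 1 ≤ k → k ≤ length xs → at d xs k ≡ at d ys k) → xs ≡ ys
at-ext d []       []       _   _    = refl
at-ext d (x ∷ xs) (y ∷ ys) len same with same 1 (s≤s z≤n) (s≤s z≤n)
... | refl = cong (x ∷_) (at-ext d xs ys (ℕP.suc-injective len)
               λ { (suc k) _ le → same (suc (suc k)) (s≤s z≤n) (s≤s le) })

All-at-++ : {A : Set} {P : A → Set} (d : A) {seg : List A} (rest : List A) → All P seg →
  ∀ {k} → 1 ≤ k → k ≤ length seg → P (at d (seg ++ rest) k)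
All-at-++ d rest (px ∷ _)  {suc zero}    _ _        = px
All-at-++ d rest (_  ∷ ps) {suc (suc k)} _ (s≤s le) = All-at-++ d rest ps (s≤s z≤n) le

All-at-infix : {A : Set} {P : A → Set} (d : A) (pre : List A) {seg : List A} (rest : List A) →
  All P seg → ∀ {k} → length pre < k → k ≤ length pre + length seg →
  P (at d (pre ++ seg ++ rest) k)
All-at-infix d []        rest ps lt le = All-at-++ d rest ps lt le
All-at-infix d (x ∷ pre) rest ps {suc (suc k)} (s≤s lt) (s≤s le) = All-at-infix d pre rest ps lt le

IndexedAll : {A : Set} → (ℕ → A → Set) → A → ℕ → List A → Set
IndexedAll P d n xs = length xs ≡ n × (∀ k → 1 ≤ k → k ≤ n → P k (at d xs k))

indexedAll-snoc : {A : Set} {P : ℕ → A → Set} {d : A} {n : ℕ} {xs : List A} {y : A} →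
  IndexedAll P d n xs → P (suc n) y → IndexedAll P d (suc n) (xs ++ y ∷ [])
indexedAll-snoc {P = P} {d} {n} {xs} {y} (refl , all) py = len , entries
  where
    len : length (xs ++ y ∷ []) ≡ suc n
    len = trans (LP.length-++ xs) (ℕP.+-comm n 1)
    entries : ∀ k → 1 ≤ k → k ≤ suc n → P k (at d (xs ++ y ∷ []) k)
    entries k 1≤k k≤ with ℕP.m≤n⇒m<n∨m≡n k≤
    ... | inj₁ (s≤s k≤n) = subst (P k) (sym (at-++ˡ d xs (y ∷ []) 1≤k k≤n)) (all k 1≤k k≤n)
    ... | inj₂ refl      = subst (P k) (sym (at-last d xs y)) py

length-filter-∘ : {A B : Set} {P : B → Set} (P? : Decidable P) (f : A → B) (xs : List A) →
  length (filter (P? ∘ f) xs) ≡ length (filter P? (map f xs))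
length-filter-∘ P? f []       = refl
length-filter-∘ P? f (x ∷ xs) with does (P? (f x))
... | true  = cong suc (length-filter-∘ P? f xs)
... | false = length-filter-∘ P? f xs

if-elim : {A : Set} (P : A → Set) (b : Bool) {x y : A} → P x → P y → P (if b then x else y)
if-elim P true  px py = px
if-elim P false px py = py

InRange : ℤ → ℤ → Set
InRange q x = q ≤ℤ x × x ≤ℤ q +ℤ + 1

Balanced : List ℤ → Set
Balanced xs = ∃ λ q → All (InRange q) xs

inRange-diff : ∀ {q x y} → InRange q x → InRange q y → y - x ≤ℤ + 1
inRange-diff {q} {x} {y} (q≤x , _) (_ , y≤q+1) =
  subst (y - x ≤ℤ_) (cancel q) (ℤP.+-mono-≤ y≤q+1 (ℤP.neg-mono-≤ q≤x))
  where
    cancel : ∀ q → (q +ℤ + 1) - q ≡ + 1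
    cancel = solve-∀

inRange-shift : ∀ c {q x} → InRange q x → InRange (q +ℤ c) (x +ℤ c)
inRange-shift c {q} {x} (q≤x , x≤q+1) =
  ℤP.+-monoˡ-≤ c q≤x , subst (x +ℤ c ≤ℤ_) (swap q c) (ℤP.+-monoˡ-≤ c x≤q+1)
  where
    swap : ∀ q c → (q +ℤ + 1) +ℤ c ≡ (q +ℤ c) +ℤ + 1
    swap = solve-∀

length-Bcomp : ∀ c m → length (Bcomp c m) ≡ m
length-Bcomp c zero    = refl
length-Bcomp c (suc m) = begin
  length (replicate (suc m ∸ c %ℕ suc m) _ ++ replicate (c %ℕ suc m) _)
    ≡⟨ LP.length-++ (replicate (suc m ∸ c %ℕ suc m) _) ⟩
  length (replicate (suc m ∸ c %ℕ suc m) (c /ℕ suc m)) + length (replicate (c %ℕ suc m) _)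
    ≡⟨ cong₂ _+_ (LP.length-replicate (suc m ∸ c %ℕ suc m)) (LP.length-replicate (c %ℕ suc m)) ⟩
  (suc m ∸ c %ℕ suc m) + c %ℕ suc m
    ≡⟨ ℕP.m∸n+n≡m (ℕP.<⇒≤ (n%ℕd<d c (suc m))) ⟩
  suc m ∎
  where
    open ≡-Reasoning

Bcomp-balanced : ∀ c m → Balanced (Bcomp c m)
Bcomp-balanced c zero    = + 0 , []
Bcomp-balanced c (suc m) = q ,
  AllP.++⁺ (AllP.replicate⁺ (suc m ∸ (c %ℕ suc m)) (ℤP.≤-refl , ℤP.i≤i+j q (+ 1)))
           (AllP.replicate⁺ (c %ℕ suc m) (ℤP.i≤i+j q (+ 1) , ℤP.≤-refl))
  where
    q : ℤ
    q = c /ℕ suc m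

decreasing-antitone : ∀ {ν} → Decreasing ν → ∀ {k k'} → 1 ≤ k → k ≤ k' → at 0 ν k' ≤ at 0 ν k
decreasing-antitone []        _ _ = z≤n
decreasing-antitone _         {suc (suc k)} {suc zero} _ (s≤s ())
decreasing-antitone [ x ]     {suc zero}    {suc zero}     _ _ = ℕP.≤-refl
decreasing-antitone [ x ]     {suc zero}    {suc (suc k')} _ _ = z≤n
decreasing-antitone [ x ]     {suc (suc k)} {suc (suc k')} _ _ = z≤n
decreasing-antitone (y≤x ∷ d) {suc zero}    {suc zero}     _ _ = ℕP.≤-refl
decreasing-antitone (y≤x ∷ d) {suc zero}    {suc (suc k')} _ _ =
  ℕP.≤-trans (decreasing-antitone d {1} {suc k'} (s≤s z≤n) (s≤s z≤n)) y≤x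
decreasing-antitone (y≤x ∷ d) {suc (suc k)} {suc (suc k')} _ (s≤s le) =
  decreasing-antitone d (s≤s z≤n) le

module Framed (μ : List ℕ) (s : List ℤ) (dec : Decreasing μ) where
  open FramAlg μ s

  mu-antitone : ∀ {k k'} → 1 ≤ k → k ≤ k' → mu k' ≤ mu k
  mu-antitone {k} {k'} 1≤k k≤k' =
    subst₂ _≤_ (sym (nthD≡at 0 μ k')) (sym (nthD≡at 0 μ k)) (decreasing-antitone dec 1≤k k≤k')

  mu-beyond : ∀ {k} → r < k → mu k ≡ 0
  mu-beyond {k} r<k = trans (nthD≡at 0 μ k) (at-beyond 0 μ r<k)

  -- number of columns of height exactly k
  width : ℕ → ℕ
  width k = mu k ∸ mu (suc k)

  BlockBalanced : List ℤ → ℕ → Set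
  BlockBalanced row k = ∃ λ q → ∀ j → mu (suc k) < j → j ≤ mu k → InRange q (at (+ 0) row j)

  RowInv : ℕ → List ℤ → Set
  RowInv i row = length row ≡ mu i × (∀ k → i ≤ k → k ≤ r → BlockBalanced row k)

  -- A block lying to the right of a row consists of default entries, hence is
  -- balanced; this covers block i of row i+1 when row i is built.
  block-beyond : ∀ row {k} → length row ≤ mu (suc k) → BlockBalanced row k
  block-beyond row short = + 0 , λ j lt _ →
    subst (InRange (+ 0)) (sym (at-beyond (+ 0) row (ℕP.≤-<-trans short lt)))
      (ℤP.≤-refl , ℤP.i≤i+j (+ 0) (+ 1))

  block-of-segment : ∀ {k} pre {seg} rest → Balanced seg →
    length pre ≡ mu (suc k) → length (pre ++ seg) ≡ mu k → BlockBalanced (pre ++ seg ++ rest) k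
  block-of-segment pre {seg} rest (q , all) len-pre len = q , λ j lt le →
    All-at-infix (+ 0) pre rest all (subst (_< j) (sym len-pre) lt)
      (subst (j ≤_) (trans (sym len) (LP.length-++ pre)) le)

  indexFrom-All : {P : ℕ → Set} (lo : ℕ) (xs : List ℤ) →
    (∀ j → lo < j → j ≤ lo + length xs → P j) → All (P ∘ proj₁) (indexFrom lo xs)
  indexFrom-All lo []       _ = []
  indexFrom-All lo (x ∷ xs) h =
    h (suc lo) ℕP.≤-refl (subst (suc lo ≤_) (sym (ℕP.+-suc lo (length xs))) (s≤s (ℕP.m≤m+n lo _)))
    ∷ indexFrom-All (suc lo) xs
        (λ j lt le → h j (ℕP.<⇒≤ lt) (subst (j ≤_) (sym (ℕP.+-suc lo (length xs))) le))

  bcomp-piece : ℕ → ℤ → ℕ → List ℤ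
  bcomp-piece k a b = take (width k) (Bcomp a b)

  lowered-piece : List ℤ → ℕ → List ℤ → List ℤ
  lowered-piece above k rs = map (λ p → lowered above (proj₁ p)) (indexFrom (mu (suc k)) rs)

  piece-fits : List ℤ → ℕ → List ℤ → Bool
  piece-fits above k rs = and (map (λ p → okAt above (proj₁ p) (proj₂ p)) (indexFrom (mu (suc k)) rs))

  segment : List ℤ → ℕ → ℤ → ℕ → List ℤ
  segment above k a b = proj₁ (stepK above k a b)

  segment-cases : ∀ (P : List ℤ → Set) above k a b →
    P (bcomp-piece k a b) → P (lowered-piece above k (bcomp-piece k a b)) → P (segment above k a b)
  segment-cases P above k a b = if-elim P (piece-fits above k (bcomp-piece k a b))

  length-bcomp-piece : ∀ k a b → width k ≤ b → length (bcomp-piece k a b) ≡ width k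
  length-bcomp-piece k a b w≤b = trans (LP.length-take (width k) (Bcomp a b))
    (trans (cong (width k ⊓_) (length-Bcomp a b)) (ℕP.m≤n⇒m⊓n≡m w≤b))

  length-lowered-piece : ∀ above k rs → length (lowered-piece above k rs) ≡ length rs
  length-lowered-piece above k rs =
    trans (LP.length-map _ (indexFrom (mu (suc k)) rs)) (length-indexFrom (mu (suc k)) rs)
    where
      length-indexFrom : ∀ lo (xs : List ℤ) → length (indexFrom lo xs) ≡ length xs
      length-indexFrom lo []       = refl
      length-indexFrom lo (x ∷ xs) = cong suc (length-indexFrom (suc lo) xs)

  segment-length : ∀ above k a b → width k ≤ b → length (segment above k a b) ≡ width k
  segment-length above k a b w≤b = segment-cases (λ seg → length seg ≡ width k) above k a b
    (length-bcomp-piece k a b w≤b)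
    (trans (length-lowered-piece above k (bcomp-piece k a b)) (length-bcomp-piece k a b w≤b))

  segment-balanced : ∀ above k a b → 1 ≤ k → BlockBalanced above k → Balanced (segment above k a b)
  segment-balanced above k a b 1≤k (q , block) =
    segment-cases Balanced above k a b from-Bcomp lowered-block
    where
      rs : List ℤ
      rs = bcomp-piece k a b
      from-Bcomp : Balanced rs
      from-Bcomp = proj₁ (Bcomp-balanced a b) , AllP.take⁺ (width k) (proj₂ (Bcomp-balanced a b))
      in-block : ∀ j → j ≤ mu (suc k) + length rs → j ≤ mu k
      in-block j le = begin
        j                         ≤⟨ le ⟩
        mu (suc k) + length rs    ≤⟨ ℕP.+-monoʳ-≤ (mu (suc k)) len-rs ⟩
        mu (suc k) + width k      ≡⟨ ℕP.m+[n∸m]≡n (mu-antitone 1≤k (ℕP.n≤1+n k)) ⟩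
        mu k                      ∎
        where
          open ℕP.≤-Reasoning
          len-rs : length rs ≤ width k
          len-rs = ℕP.≤-trans (ℕP.≤-reflexive (LP.length-take (width k) (Bcomp a b))) (ℕP.m⊓n≤m (width k) _)
      lowered-block : Balanced (lowered-piece above k rs)
      lowered-block = q - + 2 , AllP.map⁺ (indexFrom-All (mu (suc k)) rs λ j lt le →
        subst (InRange (q - + 2)) (cong (_- + 2) (sym (nthD≡at (+ 0) above j)))
          (inRange-shift (-ℤ + 2) (block j lt (in-block j le))))

  -- While row i is built, `pre` is the part computed so far: it has m cells,
  -- and the remaining budget b is the number of cells of row i still missing.
  Prefix : ℕ → ℕ → List ℤ → ℕ → Set
  Prefix i m pre b = length pre ≡ m × length pre + b ≡ mu i

  step-invariant : ∀ above {i k} a b pre → 1 ≤ k → mu k ≤ mu i → BlockBalanced above k →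
    Prefix i (mu (suc k)) pre b →
    Prefix i (mu k) (pre ++ segment above k a b) (b ∸ width k)
    × (∀ rest → BlockBalanced (pre ++ segment above k a b ++ rest) k)
  step-invariant above {i} {k} a b pre 1≤k μk≤μi block (len , budget) = (len' , budget') , blockK
    where
      seg : List ℤ
      seg = segment above k a b
      w≤b : width k ≤ b
      w≤b = begin
        width k                     ≤⟨ ℕP.∸-monoˡ-≤ (mu (suc k)) μk≤μi ⟩
        mu i ∸ mu (suc k)           ≡⟨ cong₂ _∸_ (sym budget) (sym len) ⟩
        length pre + b ∸ length pre ≡⟨ ℕP.m+n∸m≡n (length pre) b ⟩
        b                           ∎
        where open ℕP.≤-Reasoning
      len-seg : length seg ≡ width k
      len-seg = segment-length above k a b w≤b
      len' : length (pre ++ seg) ≡ mu k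
      len' = begin
        length (pre ++ seg)        ≡⟨ LP.length-++ pre ⟩
        length pre + length seg    ≡⟨ cong₂ _+_ len len-seg ⟩
        mu (suc k) + width k       ≡⟨ ℕP.m+[n∸m]≡n (mu-antitone 1≤k (ℕP.n≤1+n k)) ⟩
        mu k                       ∎
        where open ≡-Reasoning
      budget' : length (pre ++ seg) + (b ∸ width k) ≡ mu i
      budget' = begin
        length (pre ++ seg) + (b ∸ width k)       ≡⟨ cong (_+ (b ∸ width k)) (LP.length-++ pre) ⟩
        length pre + length seg + (b ∸ width k)   ≡⟨ ℕP.+-assoc (length pre) _ _ ⟩
        length pre + (length seg + (b ∸ width k)) ≡⟨ cong (λ l → length pre + (l + (b ∸ width k))) len-seg ⟩
        length pre + (width k + (b ∸ width k))    ≡⟨ cong (λ l → length pre + l) (ℕP.m+[n∸m]≡n w≤b) ⟩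
        length pre + b                            ≡⟨ budget ⟩
        mu i                                      ∎
        where open ≡-Reasoning
      blockK : ∀ rest → BlockBalanced (pre ++ seg ++ rest) k
      blockK rest = block-of-segment pre rest (segment-balanced above k a b 1≤k block) len len'

  steps-invariant : ∀ above {i} → 1 ≤ i → (∀ k → i ≤ k → k ≤ r → BlockBalanced above k) →
    ∀ d a b pre → i + d ≤ r → Prefix i (mu (suc (i + d))) pre b →
    length (pre ++ steps above i d a b) ≡ mu i
    × (∀ k → i ≤ k → k ≤ i + d → BlockBalanced (pre ++ steps above i d a b) k)
  steps-invariant above {i} 1≤i blocks zero a b pre i+0≤r prefix =
    proj₁ (proj₁ step) , block
    where
      i+0≡i : i + 0 ≡ i
      i+0≡i = ℕP.+-identityʳ i
      seg : List ℤ
      seg = segment above i a b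
      step : Prefix i (mu i) (pre ++ seg) (b ∸ width i) × (∀ rest → BlockBalanced (pre ++ seg ++ rest) i)
      step = step-invariant above a b pre 1≤i ℕP.≤-refl (blocks i ℕP.≤-refl (subst (_≤ r) i+0≡i i+0≤r))
               (subst (λ m → Prefix i (mu (suc m)) pre b) i+0≡i prefix)
      block : ∀ k → i ≤ k → k ≤ i + 0 → BlockBalanced (pre ++ seg) k
      block k i≤k k≤i = subst (BlockBalanced (pre ++ seg)) (ℕP.≤-antisym i≤k (subst (k ≤_) i+0≡i k≤i))
        (subst (λ row → BlockBalanced (pre ++ row) i) (LP.++-identityʳ seg) (proj₂ step []))
  steps-invariant above {i} 1≤i blocks (suc d) a b pre K≤r prefix = len-row , block
    where
      K : ℕ
      K = i + suc d
      K≡ : K ≡ suc (i + d)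
      K≡ = ℕP.+-suc i d
      i≤K : i ≤ K
      i≤K = ℕP.m≤m+n i (suc d)
      seg : List ℤ
      seg = segment above K a b
      a' : ℤ
      a' = proj₁ (proj₂ (stepK above K a b))
      rest : List ℤ
      rest = steps above i d a' (b ∸ width K)
      step : Prefix i (mu K) (pre ++ seg) (b ∸ width K) × (∀ rest → BlockBalanced (pre ++ seg ++ rest) K)
      step = step-invariant above a b pre (ℕP.≤-trans 1≤i i≤K) (mu-antitone 1≤i i≤K) (blocks K i≤K K≤r) prefix
      ih : length ((pre ++ seg) ++ rest) ≡ mu i
           × (∀ k → i ≤ k → k ≤ i + d → BlockBalanced ((pre ++ seg) ++ rest) k)
      ih = steps-invariant above 1≤i blocks d a' (b ∸ width K) (pre ++ seg) (ℕP.<⇒≤ (subst (_≤ r) K≡ K≤r))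
             (subst (λ m → Prefix i (mu m) (pre ++ seg) (b ∸ width K)) K≡ (proj₁ step))
      assoc : (pre ++ seg) ++ rest ≡ pre ++ seg ++ rest
      assoc = LP.++-assoc pre seg rest
      len-row : length (pre ++ seg ++ rest) ≡ mu i
      len-row = subst (λ row → length row ≡ mu i) assoc (proj₁ ih)
      block : ∀ k → i ≤ k → k ≤ K → BlockBalanced (pre ++ seg ++ rest) k
      block k i≤k k≤K with ℕP.m≤n⇒m<n∨m≡n k≤K
      ... | inj₁ k<K  = subst (λ row → BlockBalanced row k) assoc
                          (proj₂ ih k i≤k (s≤s⁻¹ (subst (k <_) K≡ k<K)))
      ... | inj₂ refl = proj₂ step rest

  row-invariant : ∀ {i} above → 1 ≤ i → i < r → RowInv (suc i) above → RowInv i (buildRow i above)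
  row-invariant {i} above 1≤i i<r (len-above , blocks-above) =
    proj₁ inv , λ k i≤k k≤r → proj₂ inv k i≤k (subst (k ≤_) (sym i+d≡r) k≤r)
    where
      i+d≡r : i + (r ∸ i) ≡ r
      i+d≡r = ℕP.m+[n∸m]≡n (ℕP.<⇒≤ i<r)
      -- block i of row i+1 lies to the right of that row
      blocks : ∀ k → i ≤ k → k ≤ r → BlockBalanced above k
      blocks k i≤k k≤r with ℕP.m≤n⇒m<n∨m≡n i≤k
      ... | inj₁ i<k  = blocks-above k i<k k≤r
      ... | inj₂ refl = block-beyond above (ℕP.≤-reflexive len-above)
      -- the empty prefix covers the columns beyond μ_{r+1} = 0
      inv : length (buildRow i above) ≡ mu i
            × (∀ k → i ≤ k → k ≤ i + (r ∸ i) → BlockBalanced (buildRow i above) k)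
      inv = steps-invariant above 1≤i blocks (r ∸ i) (sv i) (mu i) [] (ℕP.≤-reflexive i+d≡r)
              (sym (trans (cong (mu ∘ suc) i+d≡r) (mu-beyond (ℕP.n<1+n r))) , refl)

  top-row-invariant : RowInv r (Bcomp (sv r) (mu r))
  top-row-invariant = length-Bcomp (sv r) (mu r) , λ k r≤k k≤r →
    subst (BlockBalanced top) (ℕP.≤-antisym r≤k k≤r) block-r
    where
      top : List ℤ
      top = Bcomp (sv r) (mu r)
      block-r : BlockBalanced top r
      block-r = subst (λ row → BlockBalanced row r) (LP.++-identityʳ top)
        (block-of-segment [] [] (Bcomp-balanced (sv r) (mu r))
          (sym (mu-beyond (ℕP.n<1+n r))) (length-Bcomp (sv r) (mu r)))

  rowsDown-invariant : ∀ i above → i < r → RowInv (suc i) above → IndexedAll RowInv [] i (rowsDown i above)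
  rowsDown-invariant zero    above _   _   = refl , λ { (suc k) _ () }
  rowsDown-invariant (suc i) above i<r inv =
    indexedAll-snoc {P = RowInv} {xs = rowsDown i row} {y = row}
      (rowsDown-invariant i row (ℕP.<⇒≤ i<r) row-inv) row-inv
    where
      row : List ℤ
      row = buildRow (suc i) above
      row-inv : RowInv (suc i) row
      row-inv = row-invariant above (s≤s z≤n) i<r inv

fram-rows : ∀ μ s (dec : Decreasing μ) → IndexedAll (Framed.RowInv μ s dec) [] (length μ) (Fram μ s)
fram-rows []       s dec = refl , λ { (suc k) _ () }
fram-rows (x ∷ xs) s dec =
  indexedAll-snoc {P = RowInv} {xs = rowsDown (length xs) top} {y = top}
    (rowsDown-invariant (length xs) top (ℕP.n<1+n _) top-row-invariant) top-row-invariant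
  where
    open Framed (x ∷ xs) s dec
    open FramAlg (x ∷ xs) s
    top : List ℤ
    top = Bcomp (sv r) (mu r)

row-lengths : ∀ μ s → Decreasing μ → map length (Fram μ s) ≡ μ
row-lengths μ s dec = at-ext 0 (map length (Fram μ s)) μ len-eq λ k 1≤k k≤ →
  trans (at-map length [] (Fram μ s) k)
    (trans (proj₁ (proj₂ (fram-rows μ s dec) k 1≤k (subst (k ≤_) len-eq k≤))) (nthD≡at 0 μ k))
  where
    len-eq : length (map length (Fram μ s)) ≡ length μ
    len-eq = trans (LP.length-map length (Fram μ s)) (proj₁ (fram-rows μ s dec))

colHeight-Fram : ∀ μ s → Decreasing μ → ∀ j → colHeight (Fram μ s) j ≡ length (filter (j ≤?_) μ)
colHeight-Fram μ s dec j =
  trans (length-filter-∘ (j ≤?_) length (Fram μ s)) (cong (length ∘ filter (j ≤?_)) (row-lengths μ s dec))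

filter-below : ∀ {x xs j} → Decreasing (x ∷ xs) → x < j → filter (j ≤?_) (x ∷ xs) ≡ []
filter-below {j = j} [ x ]     x<j = LP.filter-reject (j ≤?_) (ℕP.<⇒≱ x<j)
filter-below {j = j} (y≤x ∷ d) x<j =
  trans (LP.filter-reject (j ≤?_) (ℕP.<⇒≱ x<j)) (filter-below d (ℕP.≤-<-trans y≤x x<j))

count-zero-head : ∀ {j y ys} → length (filter (j ≤?_) (y ∷ ys)) ≡ 0 → y < j
count-zero-head {j} none =
  ℕP.≰⇒> λ j≤y → ℕP.1+n≢0 (trans (sym (cong length (LP.filter-accept (j ≤?_) j≤y))) none)

column-block : ∀ {μ j} → Decreasing μ → 1 ≤ j → ∀ n → 1 ≤ n →
  length (filter (j ≤?_) μ) ≡ n → at 0 μ (suc n) < j × j ≤ at 0 μ n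
column-block {[]} _ _ (suc n) _ ()
column-block {x ∷ xs} {j} dec 1≤j (suc n) _ count with j ≤? x
... | no j≰x = ⊥-elim (ℕP.1+n≢0 (trans (sym count) (cong length (filter-below dec (ℕP.≰⇒> j≰x)))))
... | yes j≤x =
  tail-block dec n (ℕP.suc-injective (trans (sym (cong length (LP.filter-accept (j ≤?_) j≤x))) count))
  where
    tail-block : Decreasing (x ∷ xs) → ∀ m → length (filter (j ≤?_) xs) ≡ m →
      at 0 (x ∷ xs) (suc (suc m)) < j × j ≤ at 0 (x ∷ xs) (suc m)
    tail-block [ _ ]   zero    _          = 1≤j , j≤x
    tail-block (_ ∷ _) zero    none       = count-zero-head none , j≤x
    tail-block (_ ∷ d) (suc m) tail-count = column-block d 1≤j (suc m) (s≤s z≤n) tail-count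

same-height-entries : ∀ μ s → Decreasing μ → ∀ {i j n k} → 1 ≤ i → i < j →
  length (filter (i ≤?_) μ) ≡ n → length (filter (j ≤?_) μ) ≡ n → 1 ≤ k → k ≤ n →
  entry (Fram μ s) k j - entry (Fram μ s) k i ≤ℤ + 1
same-height-entries μ s dec {i} {j} {n} {k} 1≤i i<j count-i count-j 1≤k k≤n =
  subst₂ (λ y x → y - x ≤ℤ + 1) (sym (entry≡at j)) (sym (entry≡at i))
    (inRange-diff (in-block i 1≤i count-i) (in-block j (ℕP.≤-trans 1≤i (ℕP.<⇒≤ i<j)) count-j))
  where
    open Framed μ s dec
    row : List ℤ
    row = at [] (Fram μ s) k
    n≤r : n ≤ length μ
    n≤r = subst (_≤ length μ) count-i (LP.length-filter (i ≤?_) μ)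
    block : BlockBalanced row n
    block = proj₂ (proj₂ (fram-rows μ s dec) k 1≤k (ℕP.≤-trans k≤n n≤r)) n k≤n n≤r
    in-block : ∀ c → 1 ≤ c → length (filter (c ≤?_) μ) ≡ n → InRange (proj₁ block) (at (+ 0) row c)
    in-block c 1≤c count with column-block dec 1≤c n (ℕP.≤-trans 1≤k k≤n) count
    ... | right-of , left-of = proj₂ block c (subst (_< c) (sym (nthD≡at 0 μ (suc n))) right-of)
                                             (subst (c ≤_) (sym (nthD≡at 0 μ n)) left-of)
    entry≡at : ∀ c → entry (Fram μ s) k c ≡ at (+ 0) row c
    entry≡at c = trans (nthD≡at (+ 0) (nthD [] (Fram μ s) k) c)
                       (cong (λ row → at (+ 0) row c) (nthD≡at [] (Fram μ s) k))

-- A framed tableau is Fram(μ, s) with μ a partition; its column heights are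
-- counts of parts, so the theorem is the previous lemma.
mainTheorem11 : (T : Tableau) → IsFramed T →
    (i j : ℕ) → 1 ≤ i → i < j → colHeight T i ≡ colHeight T j →
    (k : ℕ) → 1 ≤ k → k ≤ colHeight T i →
    entry T k j - entry T k i ≤ℤ + 1
mainTheorem11 T (μ , s , ((dec , _) , _) , refl) i j 1≤i i<j same-height k 1≤k k≤height =
  same-height-entries μ s dec 1≤i i<j refl count-j 1≤k (subst (k ≤_) (height i) k≤height)
  where
    height : ∀ c → colHeight (Fram μ s) c ≡ length (filter (c ≤?_) μ)
    height = colHeight-Fram μ s dec
    count-j : length (filter (j ≤?_) μ) ≡ length (filter (i ≤?_) μ)
    count-j = trans (sym (height j)) (trans (sym same-height) (height i))
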